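{- Every partial Hadamard matrix $H\in M_{4\times N}(\pm1)$ is equivalent to a matrix of the form $(\underbrace{W_4\ \cdots\ W_4}_{a}\ \underbrace{K_4\ \cdots\ K_4}_{b})$ (horizontal concatenation of $a$ copies of $W_4$ and $b$ copies of $K_4$), with integers $a,b\ge0$ satisfying $a+b=N/4$; moreover, one can choose such $a,b$ with $a\ge b$.
   Context: A partial Hadamard matrix is a matrix $H\in M_{M\times N}(\pm1)$ whose rows are pairwise orthogonal in $\mathbb{R}^N$. Two such matrices are equivalent if one can pass from one to the other by permuting rows, permuting columns, and multiplying rows or columns by $-1$. Here $W_4=\begin{pmatrix}1&1&1&1\\1&-1&1&-1\\1&1&-1&-1\\1&-1&-1&1\end{pmatrix}$ and $K_4=\begin{pmatrix}-1&1&1&1\\1&-1&1&1\\1&1&-1&1\\1&1&1&-1\end{pmatrix}$. -}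

module Defs where

open import Data.Nat as ℕ using (ℕ)
open import Data.Fin using (Fin; zero; suc)
open import Data.Integer using (ℤ; +_; -_; _*_; _+_; 0ℤ; 1ℤ; -1ℤ)
open import Data.Vec.Functional as VF using (Vector)
open import Data.Fin.Permutation using (Permutation; Permutation′; _⟨$⟩ʳ_)
open import Data.Sum using (_⊎_)
open import Data.Product using (Σ; ∃; ∃-syntax; _×_)
open import Relation.Binary.PropositionalEquality using (_≡_; _≢_)

Matrix : ℕ → ℕ → Set
Matrix M N = Fin M → Fin N → ℤ

IsSign : ℤ → Set
IsSign x = (x ≡ 1ℤ) ⊎ (x ≡ -1ℤ)

sumℤ : ∀ {N} → Vector ℤ N → ℤ
sumℤ = VF.foldr _+_ 0ℤ

dot : ∀ {N} → Vector ℤ N → Vector ℤ N → ℤ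
dot u v = sumℤ (λ j → u j * v j)

IsPartialHadamard : ∀ {M N} → Matrix M N → Set
IsPartialHadamard {M} {N} H =
  (∀ i j → IsSign (H i j)) ×
  (∀ (i k : Fin M) → i ≢ k → dot (H i) (H k) ≡ 0ℤ)

-- Equivalence: H' is obtained from H by permuting rows, permuting columns,
-- and multiplying rows and columns by -1.  Any composite of these operations
-- has the form  H'(i,j) = r_i c_j H(σ i, τ j)  with σ, τ permutations and
-- r, c sign vectors, and every such form is such a composite.
-- (The column permutation is allowed to be a bijection Fin N' ↔ Fin N so
-- that matrices whose widths are only propositionally equal can be compared;
-- its existence forces N' = N.)
Equivalent : ∀ {M N N'} → Matrix M N → Matrix M N' → Set
Equivalent {M} {N} {N'} H H' =
  Σ (Permutation′ M) λ σ →
  Σ (Permutation N' N) λ τ →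
  Σ (Vector ℤ M) λ r →
  Σ (Vector ℤ N') λ c →
    (∀ i → IsSign (r i)) × (∀ j → IsSign (c j)) ×
    (∀ i j → H' i j ≡ r i * c j * H (σ ⟨$⟩ʳ i) (τ ⟨$⟩ʳ j))

W₄ : Matrix 4 4
W₄ = VF.fromList
  ( VF.fromList (1ℤ ∷ 1ℤ ∷ 1ℤ ∷ 1ℤ ∷ [])
  ∷ VF.fromList (1ℤ ∷ -1ℤ ∷ 1ℤ ∷ -1ℤ ∷ [])
  ∷ VF.fromList (1ℤ ∷ 1ℤ ∷ -1ℤ ∷ -1ℤ ∷ [])
  ∷ VF.fromList (1ℤ ∷ -1ℤ ∷ -1ℤ ∷ 1ℤ ∷ [])
  ∷ [])
  where open import Data.List using (_∷_; [])

K₄ : Matrix 4 4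
K₄ = VF.fromList
  ( VF.fromList (-1ℤ ∷ 1ℤ ∷ 1ℤ ∷ 1ℤ ∷ [])
  ∷ VF.fromList (1ℤ ∷ -1ℤ ∷ 1ℤ ∷ 1ℤ ∷ [])
  ∷ VF.fromList (1ℤ ∷ 1ℤ ∷ -1ℤ ∷ 1ℤ ∷ [])
  ∷ VF.fromList (1ℤ ∷ 1ℤ ∷ 1ℤ ∷ -1ℤ ∷ [])
  ∷ [])
  where open import Data.List using (_∷_; [])

WK : (a b : ℕ) → Matrix 4 (a ℕ.* 4 ℕ.+ b ℕ.* 4)
WK a b i = VF.concat (VF.replicate a (W₄ i)) VF.++ VF.concat (VF.replicate b (K₄ i))

module Submission where

-- Multiply every column of H by its first entry ("dephasing"); the column
-- is then determined by its pattern  (h₀h₁, h₀h₂, h₀h₃) ∈ {±1}³.  For a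
-- sign triple w = (w₁, w₂, w₃) the indicator of "pattern = w" is
-- (1 + w₁x)(1 + w₂y)(1 + w₃z)/8, so summing over the columns expresses
-- 8·#{columns with pattern w} through N, the row sums of the dephased
-- matrix, the inner products of its rows and the sum Q of the products
-- xyz.  Orthogonality kills everything except N and Q, leaving
--            8·#{columns with pattern w} = N + w₁w₂w₃·Q.
-- Hence the multiplicity of a pattern depends only on its parity w₁w₂w₃.
-- The columns of W₄ realise the four even patterns and those of K₄ the
-- four odd ones, so H and (W₄ ⋯ W₄ K₄ ⋯ K₄) — with a = #even-pattern
-- columns and b = #odd-pattern columns — have the same multiset of
-- patterns, and a column permutation matching patterns together with
-- suitable signs is an equivalence.  Negating row 1 negates Q and swaps
-- a and b, which lets us arrange b ≤ a.

open import Defs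
open import Data.Nat using (ℕ; zero; suc; _*_; _+_; _≤_; _≤?_)
import Data.Nat.Properties as ℕP
import Data.Nat.Tactic.RingSolver as ℕSolver
open import Data.Integer as ℤ using (ℤ; +_; 0ℤ; 1ℤ; -1ℤ)
import Data.Integer.Properties as ℤP
open import Data.Integer.Tactic.RingSolver using (solve-∀)
open import Data.Fin as Fin using (Fin; zero; suc; splitAt)
open import Data.Fin.Patterns using (0F; 1F; 2F; 3F)
open import Data.Fin.Permutation using (Permutation; _⟨$⟩ʳ_; id; insert; insert-punchIn)
open import Data.Fin.Properties using (all?)
open import Data.Vec.Functional using (Vector; _++_; concat; replicate; removeAt)
open import Data.Vec.Functional.Relation.Unary.All.Properties using (++⁺)
open import Data.Product using (Σ; _×_; _,_; proj₁; proj₂)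
open import Data.Sum using (inj₁; inj₂)
open import Data.Bool using (true; false; if_then_else_)
open import Data.Unit using (tt)
open import Data.Empty using (⊥-elim)
open import Function using (_∘_)
open import Relation.Nullary using (Dec; yes; no; does; _because_; ¬?)
open import Relation.Nullary.Decidable using (_×-dec_; _⊎-dec_; _→-dec_; map′; toWitness)
open import Relation.Binary.Definitions using (DecidableEquality)
open import Relation.Binary.PropositionalEquality
  using (_≡_; refl; sym; trans; cong; cong₂; subst; subst₂; _≢_; _≗_; module ≡-Reasoning)
import Algebra.Properties.CommutativeMonoid.Sum ℕP.+-0-commutativeMonoid as ℕΣ
import Algebra.Properties.Semiring.Sum ℤP.+-*-semiring as ℤΣ

open ≡-Reasoning

sign-mul : ∀ {x y} → IsSign x → IsSign y → IsSign (x ℤ.* y)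
sign-mul (inj₁ refl) (inj₁ refl) = inj₁ refl
sign-mul (inj₁ refl) (inj₂ refl) = inj₂ refl
sign-mul (inj₂ refl) (inj₁ refl) = inj₂ refl
sign-mul (inj₂ refl) (inj₂ refl) = inj₁ refl

sign-square : ∀ {x} → IsSign x → x ℤ.* x ≡ 1ℤ
sign-square (inj₁ refl) = refl
sign-square (inj₂ refl) = refl

sign? : ∀ x → Dec (IsSign x)
sign? x = (x ℤ.≟ 1ℤ) ⊎-dec (x ℤ.≟ -1ℤ)

sign-solve : ∀ {a b x y} → IsSign b → a ℤ.* x ≡ b ℤ.* y → y ≡ b ℤ.* a ℤ.* x
sign-solve {a} {b} {x} {y} sb ax≡by = begin
  y                   ≡⟨ sym (ℤP.*-identityˡ y) ⟩
  1ℤ ℤ.* y            ≡⟨ cong (ℤ._* y) (sym (sign-square sb)) ⟩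
  b ℤ.* b ℤ.* y       ≡⟨ ℤP.*-assoc b b y ⟩
  b ℤ.* (b ℤ.* y)     ≡⟨ cong (b ℤ.*_) (sym ax≡by) ⟩
  b ℤ.* (a ℤ.* x)     ≡⟨ sym (ℤP.*-assoc b a x) ⟩
  b ℤ.* a ℤ.* x       ∎

-- sumℤ from Defs is definitionally the library's  sum  for ℤ, so the
-- summation lemmas of Algebra.Properties.Semiring.Sum apply to it.

dot-scale : ∀ {N} r s (u v : Vector ℤ N) →
  dot (λ j → r ℤ.* u j) (λ j → s ℤ.* v j) ≡ r ℤ.* s ℤ.* dot u v
dot-scale r s u v = begin
  sumℤ (λ j → r ℤ.* u j ℤ.* (s ℤ.* v j))
    ≡⟨ ℤΣ.sum-cong-≗ (λ j → regroup r s (u j) (v j)) ⟩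
  sumℤ (λ j → r ℤ.* s ℤ.* (u j ℤ.* v j))
    ≡⟨ sym (ℤΣ.*-distribˡ-sum (r ℤ.* s) (λ j → u j ℤ.* v j)) ⟩
  r ℤ.* s ℤ.* dot u v ∎
  where
  regroup : ∀ r s x y → r ℤ.* x ℤ.* (s ℤ.* y) ≡ r ℤ.* s ℤ.* (x ℤ.* y)
  regroup = solve-∀

dot-dephase : ∀ {N} (h u v : Vector ℤ N) → (∀ j → IsSign (h j)) →
  dot (λ j → h j ℤ.* u j) (λ j → h j ℤ.* v j) ≡ dot u v
dot-dephase h u v sh = ℤΣ.sum-cong-≗ λ j → begin
  h j ℤ.* u j ℤ.* (h j ℤ.* v j)   ≡⟨ regroup (h j) (u j) (v j) ⟩
  h j ℤ.* h j ℤ.* (u j ℤ.* v j)   ≡⟨ cong (ℤ._* (u j ℤ.* v j)) (sign-square (sh j)) ⟩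
  1ℤ ℤ.* (u j ℤ.* v j)            ≡⟨ ℤP.*-identityˡ _ ⟩
  u j ℤ.* v j                     ∎
  where
  regroup : ∀ h x y → h ℤ.* x ℤ.* (h ℤ.* y) ≡ h ℤ.* h ℤ.* (x ℤ.* y)
  regroup = solve-∀

ind : ∀ {P : Set} → Dec P → ℕ
ind d = if does d then 1 else 0

ind-× : ∀ {P Q : Set} (p : Dec P) (q : Dec Q) → ind (p ×-dec q) ≡ ind p * ind q
ind-× (true because _) q = sym (ℕP.+-identityʳ (ind q))
ind-× (false because _) q = refl

++-tail : ∀ {A : Set} {m n} (f : Vector A (suc m)) (g : Vector A n) →
  ∀ j → (f ++ g) (suc j) ≡ ((f ∘ suc) ++ g) j
++-tail {m = m} f g j with splitAt m j
... | inj₁ _ = refl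
... | inj₂ _ = refl

concat-replicate-suc : ∀ {A : Set} {m} a (f : Vector A m) →
  ∀ j → concat (replicate (suc a) f) j ≡ (f ++ concat (replicate a f)) j
concat-replicate-suc {m = m} a f j with splitAt m j
... | inj₁ _ = refl
... | inj₂ _ = refl

module Counting {A : Set} (_≟_ : DecidableEquality A) where

  count : ∀ {n} → Vector A n → A → ℕ
  count t x = ℕΣ.sum (λ j → ind (t j ≟ x))

  count-cong : ∀ {n} {t t′ : Vector A n} → t ≗ t′ → ∀ x → count t x ≡ count t′ x
  count-cong t≗t′ x = ℕΣ.sum-cong-≗ (λ j → cong (λ y → ind (y ≟ x)) (t≗t′ j))

  count-absent : ∀ {n} (t : Vector A n) x → (∀ j → t j ≢ x) → count t x ≡ 0
  count-absent {zero} t x absent = refl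
  count-absent {suc n} t x absent with t zero ≟ x
  ... | yes t₀≡x = ⊥-elim (absent zero t₀≡x)
  ... | no _ = count-absent (t ∘ suc) x (absent ∘ suc)

  count-occurs : ∀ {n} (t : Vector A n) x → count t x ≢ 0 → Σ (Fin n) λ i → t i ≡ x
  count-occurs {zero} t x c≢0 = ⊥-elim (c≢0 refl)
  count-occurs {suc n} t x c≢0 with t zero ≟ x
  ... | yes t₀≡x = zero , t₀≡x
  ... | no _ = let (i , tᵢ≡x) = count-occurs (t ∘ suc) x c≢0 in suc i , tᵢ≡x

  count-self : ∀ {n} (t : Vector A (suc n)) → count t (t zero) ≢ 0
  count-self t with t zero ≟ t zero
  ... | yes _ = λ ()
  ... | no t₀≢t₀ = ⊥-elim (t₀≢t₀ refl)

  count-++ : ∀ {m n} (f : Vector A m) (g : Vector A n) x →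
    count (f ++ g) x ≡ count f x + count g x
  count-++ {zero} f g x = refl
  count-++ {suc m} f g x = begin
    ind (f zero ≟ x) + count ((f ++ g) ∘ suc) x
      ≡⟨ cong (_+_ (ind (f zero ≟ x))) (count-cong (++-tail f g) x) ⟩
    ind (f zero ≟ x) + count ((f ∘ suc) ++ g) x
      ≡⟨ cong (_+_ (ind (f zero ≟ x))) (count-++ (f ∘ suc) g x) ⟩
    ind (f zero ≟ x) + (count (f ∘ suc) x + count g x)
      ≡⟨ sym (ℕP.+-assoc (ind (f zero ≟ x)) _ _) ⟩
    count f x + count g x ∎

  count-concat-replicate : ∀ {m} a (f : Vector A m) x →
    count (concat (replicate a f)) x ≡ a * count f x
  count-concat-replicate zero f x = refl
  count-concat-replicate (suc a) f x = begin
    count (concat (replicate (suc a) f)) x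
      ≡⟨ count-cong (concat-replicate-suc a f) x ⟩
    count (f ++ concat (replicate a f)) x
      ≡⟨ count-++ f _ x ⟩
    count f x + count (concat (replicate a f)) x
      ≡⟨ cong (_+_ (count f x)) (count-concat-replicate a f x) ⟩
    count f x + a * count f x ∎

  matching-permutation : ∀ {m n} (f : Vector A m) (g : Vector A n) →
    (∀ x → count f x ≡ count g x) →
    Σ (Permutation n m) λ τ → ∀ j → f (τ ⟨$⟩ʳ j) ≡ g j
  matching-permutation {zero} {zero} f g same = id , λ ()
  matching-permutation {suc m} {zero} f g same = ⊥-elim (count-self f (same (f zero)))
  matching-permutation {m} {suc n} f g same
    with count-occurs f (g zero) (λ c≡0 → count-self g (trans (sym (same (g zero))) c≡0))
  matching-permutation {suc m} {suc n} f g same | i , fᵢ≡g₀ =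
    insert zero i π , matched
    where
    rest : ∀ y → count (removeAt f i) y ≡ count (g ∘ suc) y
    rest y = ℕP.+-cancelˡ-≡ (ind (g zero ≟ y)) _ _ (begin
      ind (g zero ≟ y) + count (removeAt f i) y
        ≡⟨ cong (λ z → ind (z ≟ y) + count (removeAt f i) y) fᵢ≡g₀ ⟨
      ind (f i ≟ y) + count (removeAt f i) y
        ≡⟨ ℕΣ.sum-remove (λ j → ind (f j ≟ y)) ⟨
      count f y
        ≡⟨ same y ⟩
      count g y ∎)
    recursive : Σ (Permutation n m) λ π → ∀ j → removeAt f i (π ⟨$⟩ʳ j) ≡ g (suc j)
    recursive = matching-permutation (removeAt f i) (g ∘ suc) rest
    π : Permutation n m
    π = proj₁ recursive
    matched : ∀ j → f (insert zero i π ⟨$⟩ʳ j) ≡ g j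
    matched zero = fᵢ≡g₀
    matched (suc j) = trans (cong f (insert-punchIn zero i π j)) (proj₂ recursive j)

-- Sign triples (w₁, w₂, w₃) ∈ {±1}³ classify dephased 4-row columns; their
-- parity is w₁w₂w₃.
Triple : Set
Triple = ℤ × ℤ × ℤ

IsSignTriple : Triple → Set
IsSignTriple (x , y , z) = IsSign x × IsSign y × IsSign z

signTriple? : ∀ v → Dec (IsSignTriple v)
signTriple? (x , y , z) = sign? x ×-dec sign? y ×-dec sign? z

parity : Triple → ℤ
parity (x , y , z) = x ℤ.* y ℤ.* z

parity-sign : ∀ {v} → IsSignTriple v → IsSign (parity v)
parity-sign (sx , sy , sz) = sign-mul (sign-mul sx sy) sz

e₊ e₋ : Triple
e₊ = (1ℤ , 1ℤ , 1ℤ)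
e₋ = (-1ℤ , -1ℤ , -1ℤ)

e₊-sign : IsSignTriple e₊
e₊-sign = inj₁ refl , inj₁ refl , inj₁ refl

e₋-sign : IsSignTriple e₋
e₋-sign = inj₂ refl , inj₂ refl , inj₂ refl

_≟₃_ : DecidableEquality Triple
(x , y , z) ≟₃ (a , b , c) =
  map′ (λ { (refl , refl , refl) → refl }) (λ { refl → refl , refl , refl })
       ((x ℤ.≟ a) ×-dec (y ℤ.≟ b) ×-dec (z ℤ.≟ c))

open Counting _≟₃_

-- The pattern of a ±1 column c is (c₀c₁, c₀c₂, c₀c₃): the column c₀·c,
-- normalised to start with 1, without that first entry.
patternOf : (Fin 4 → ℤ) → Triple
patternOf c = (c 0F ℤ.* c 1F , c 0F ℤ.* c 2F , c 0F ℤ.* c 3F)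

patterns : ∀ {N} → Matrix 4 N → Vector Triple N
patterns H j = patternOf (λ i → H i j)

pattern-sign : ∀ {N} {H : Matrix 4 N} → (∀ i j → IsSign (H i j)) →
  ∀ j → IsSignTriple (patterns H j)
pattern-sign sH j =
  sign-mul (sH 0F j) (sH 1F j) , sign-mul (sH 0F j) (sH 2F j) , sign-mul (sH 0F j) (sH 3F j)

coordinate-indicator : ∀ {x a} → IsSign x → IsSign a → + (2 * ind (x ℤ.≟ a)) ≡ 1ℤ ℤ.+ a ℤ.* x
coordinate-indicator (inj₁ refl) (inj₁ refl) = refl
coordinate-indicator (inj₁ refl) (inj₂ refl) = refl
coordinate-indicator (inj₂ refl) (inj₁ refl) = refl
coordinate-indicator (inj₂ refl) (inj₂ refl) = refl

indicator-expansion : ∀ {x y z a b c} → IsSignTriple (x , y , z) → IsSignTriple (a , b , c) →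
  + (8 * ind ((x , y , z) ≟₃ (a , b , c)))
    ≡ (1ℤ ℤ.+ a ℤ.* x) ℤ.* ((1ℤ ℤ.+ b ℤ.* y) ℤ.* (1ℤ ℤ.+ c ℤ.* z))
indicator-expansion {x} {y} {z} {a} {b} {c} (sx , sy , sz) (sa , sb , sc) = begin
  + (8 * ind ((x ℤ.≟ a) ×-dec (y ℤ.≟ b) ×-dec (z ℤ.≟ c)))
    ≡⟨ cong (λ k → + (8 * k)) (trans (ind-× (x ℤ.≟ a) ((y ℤ.≟ b) ×-dec (z ℤ.≟ c)))
                                    (cong (I *_) (ind-× (y ℤ.≟ b) (z ℤ.≟ c)))) ⟩
  + (8 * (I * (J * K)))
    ≡⟨ cong +_ (halve I J K) ⟩
  + (2 * I * (2 * J * (2 * K)))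
    ≡⟨ trans (ℤP.pos-* (2 * I) _) (cong (+ (2 * I) ℤ.*_) (ℤP.pos-* (2 * J) _)) ⟩
  + (2 * I) ℤ.* (+ (2 * J) ℤ.* + (2 * K))
    ≡⟨ cong₂ ℤ._*_ (coordinate-indicator sx sa)
                   (cong₂ ℤ._*_ (coordinate-indicator sy sb) (coordinate-indicator sz sc)) ⟩
  (1ℤ ℤ.+ a ℤ.* x) ℤ.* ((1ℤ ℤ.+ b ℤ.* y) ℤ.* (1ℤ ℤ.+ c ℤ.* z)) ∎
  where
  I J K : ℕ
  I = ind (x ℤ.≟ a)
  J = ind (y ℤ.≟ b)
  K = ind (z ℤ.≟ c)
  halve : ∀ i j k → 8 * (i * (j * k)) ≡ 2 * i * (2 * j * (2 * k))
  halve = ℕSolver.solve-∀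

triple-count-expansion : ∀ {N} (u₁ u₂ u₃ : Vector ℤ N) →
  (∀ j → IsSignTriple (u₁ j , u₂ j , u₃ j)) →
  ∀ {a b c} → IsSignTriple (a , b , c) →
  + (8 * count (λ j → (u₁ j , u₂ j , u₃ j)) (a , b , c))
    ≡ + N ℤ.+ (a ℤ.* sumℤ u₁ ℤ.+ b ℤ.* sumℤ u₂ ℤ.+ c ℤ.* sumℤ u₃)
          ℤ.+ (a ℤ.* b ℤ.* dot u₁ u₂ ℤ.+ a ℤ.* c ℤ.* dot u₁ u₃ ℤ.+ b ℤ.* c ℤ.* dot u₂ u₃)
          ℤ.+ a ℤ.* b ℤ.* c ℤ.* sumℤ (λ j → u₁ j ℤ.* u₂ j ℤ.* u₃ j)
triple-count-expansion {zero} u₁ u₂ u₃ su {a} {b} {c} sw = no-columns a b c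
  where
  no-columns : ∀ a b c → 0ℤ ≡ 0ℤ ℤ.+ (a ℤ.* 0ℤ ℤ.+ b ℤ.* 0ℤ ℤ.+ c ℤ.* 0ℤ)
    ℤ.+ (a ℤ.* b ℤ.* 0ℤ ℤ.+ a ℤ.* c ℤ.* 0ℤ ℤ.+ b ℤ.* c ℤ.* 0ℤ) ℤ.+ a ℤ.* b ℤ.* c ℤ.* 0ℤ
  no-columns = solve-∀
triple-count-expansion {suc N} u₁ u₂ u₃ su {a} {b} {c} sw =
  trans (cong +_ (ℕP.*-distribˡ-+ 8 (ind (t zero ≟₃ (a , b , c))) _))
  (trans (cong₂ ℤ._+_ (indicator-expansion (su zero) sw)
                      (triple-count-expansion (u₁ ∘ suc) (u₂ ∘ suc) (u₃ ∘ suc) (su ∘ suc) sw))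
         (add-column a b c (u₁ zero) (u₂ zero) (u₃ zero) (+ N) _ _ _ _ _ _ _))
  where
  t : Vector Triple (suc N)
  t j = (u₁ j , u₂ j , u₃ j)
  add-column : ∀ a b c x y z n s₁ s₂ s₃ d₁₂ d₁₃ d₂₃ q →
    (1ℤ ℤ.+ a ℤ.* x) ℤ.* ((1ℤ ℤ.+ b ℤ.* y) ℤ.* (1ℤ ℤ.+ c ℤ.* z))
      ℤ.+ (n ℤ.+ (a ℤ.* s₁ ℤ.+ b ℤ.* s₂ ℤ.+ c ℤ.* s₃)
             ℤ.+ (a ℤ.* b ℤ.* d₁₂ ℤ.+ a ℤ.* c ℤ.* d₁₃ ℤ.+ b ℤ.* c ℤ.* d₂₃)
             ℤ.+ a ℤ.* b ℤ.* c ℤ.* q)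
    ≡ 1ℤ ℤ.+ n
      ℤ.+ (a ℤ.* (x ℤ.+ s₁) ℤ.+ b ℤ.* (y ℤ.+ s₂) ℤ.+ c ℤ.* (z ℤ.+ s₃))
      ℤ.+ (a ℤ.* b ℤ.* (x ℤ.* y ℤ.+ d₁₂) ℤ.+ a ℤ.* c ℤ.* (x ℤ.* z ℤ.+ d₁₃)
             ℤ.+ b ℤ.* c ℤ.* (y ℤ.* z ℤ.+ d₂₃))
      ℤ.+ a ℤ.* b ℤ.* c ℤ.* (x ℤ.* y ℤ.* z ℤ.+ q)
  add-column = solve-∀

patternParitySum : ∀ {N} → Matrix 4 N → ℤ
patternParitySum H = sumℤ (λ j → parity (patterns H j))

pattern-count-formula : ∀ {N} {H : Matrix 4 N} → IsPartialHadamard H →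
  ∀ {w} → IsSignTriple w →
  + (8 * count (patterns H) w) ≡ + N ℤ.+ parity w ℤ.* patternParitySum H
pattern-count-formula {N} {H} (sH , orth) {a , b , c} sw = begin
  + (8 * count (patterns H) (a , b , c))
    ≡⟨ triple-count-expansion (u 1F) (u 2F) (u 3F) (pattern-sign sH) sw ⟩
  + N ℤ.+ (a ℤ.* sumℤ (u 1F) ℤ.+ b ℤ.* sumℤ (u 2F) ℤ.+ c ℤ.* sumℤ (u 3F))
      ℤ.+ (a ℤ.* b ℤ.* dot (u 1F) (u 2F) ℤ.+ a ℤ.* c ℤ.* dot (u 1F) (u 3F)
             ℤ.+ b ℤ.* c ℤ.* dot (u 2F) (u 3F))
      ℤ.+ a ℤ.* b ℤ.* c ℤ.* Q
    ≡⟨ cong₂ (λ first second → + N ℤ.+ first ℤ.+ second ℤ.+ a ℤ.* b ℤ.* c ℤ.* Q)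
         (cong₂ (λ s₁₂ s₃ → s₁₂ ℤ.+ c ℤ.* s₃)
           (cong₂ (λ s₁ s₂ → a ℤ.* s₁ ℤ.+ b ℤ.* s₂) (orth 0F 1F λ ()) (orth 0F 2F λ ()))
           (orth 0F 3F λ ()))
         (cong₂ (λ d₁₂₁₃ d₂₃ → d₁₂₁₃ ℤ.+ b ℤ.* c ℤ.* d₂₃)
           (cong₂ (λ d₁₂ d₁₃ → a ℤ.* b ℤ.* d₁₂ ℤ.+ a ℤ.* c ℤ.* d₁₃)
             (dephased-orthogonal 1F 2F λ ()) (dephased-orthogonal 1F 3F λ ()))
           (dephased-orthogonal 2F 3F λ ())) ⟩
  + N ℤ.+ (a ℤ.* 0ℤ ℤ.+ b ℤ.* 0ℤ ℤ.+ c ℤ.* 0ℤ)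
      ℤ.+ (a ℤ.* b ℤ.* 0ℤ ℤ.+ a ℤ.* c ℤ.* 0ℤ ℤ.+ b ℤ.* c ℤ.* 0ℤ)
      ℤ.+ a ℤ.* b ℤ.* c ℤ.* Q
    ≡⟨ drop-zeros (+ N) a b c Q ⟩
  + N ℤ.+ a ℤ.* b ℤ.* c ℤ.* Q ∎
  where
  Q : ℤ
  Q = patternParitySum H
  -- the rows of the dephased matrix; their sums are ⟨H₀, Hₖ⟩
  u : Fin 4 → Vector ℤ N
  u k j = H 0F j ℤ.* H k j
  dephased-orthogonal : ∀ i k → i ≢ k → dot (u i) (u k) ≡ 0ℤ
  dephased-orthogonal i k i≢k = trans (dot-dephase (H 0F) (H i) (H k) (sH 0F)) (orth i k i≢k)
  drop-zeros : ∀ n a b c q →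
    n ℤ.+ (a ℤ.* 0ℤ ℤ.+ b ℤ.* 0ℤ ℤ.+ c ℤ.* 0ℤ)
      ℤ.+ (a ℤ.* b ℤ.* 0ℤ ℤ.+ a ℤ.* c ℤ.* 0ℤ ℤ.+ b ℤ.* c ℤ.* 0ℤ)
      ℤ.+ a ℤ.* b ℤ.* c ℤ.* q
    ≡ n ℤ.+ a ℤ.* b ℤ.* c ℤ.* q
  drop-zeros = solve-∀

cancel-8 : ∀ {m n} → + (8 * m) ≡ + (8 * n) → m ≡ n
cancel-8 e = ℕP.*-cancelˡ-≡ _ _ 8 (ℤP.+-injective e)

ParityInvariant : ∀ {N} → Vector Triple N → Set
ParityInvariant t = ∀ {v w} → IsSignTriple v → IsSignTriple w →
  parity v ≡ parity w → count t v ≡ count t w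

partialHadamard-parityInvariant : ∀ {N} {H : Matrix 4 N} → IsPartialHadamard H →
  ParityInvariant (patterns H)
partialHadamard-parityInvariant {N} {H} ph {v} {w} sv sw pv≡pw =
  cancel-8 (begin
    + (8 * count (patterns H) v)                    ≡⟨ pattern-count-formula ph sv ⟩
    + N ℤ.+ parity v ℤ.* patternParitySum H          ≡⟨ cong (λ p → + N ℤ.+ p ℤ.* patternParitySum H) pv≡pw ⟩
    + N ℤ.+ parity w ℤ.* patternParitySum H          ≡⟨ pattern-count-formula ph sw ⟨
    + (8 * count (patterns H) w)                    ∎)

parityInvariant-agree : ∀ {m n} (t : Vector Triple m) (t′ : Vector Triple n) →
  (∀ j → IsSignTriple (t j)) → (∀ j → IsSignTriple (t′ j)) →
  ParityInvariant t → ParityInvariant t′ →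
  count t e₊ ≡ count t′ e₊ → count t e₋ ≡ count t′ e₋ →
  ∀ x → count t x ≡ count t′ x
parityInvariant-agree t t′ st st′ inv inv′ same₊ same₋ x with signTriple? x
... | no ¬sx = trans (count-absent t x (λ j tⱼ≡x → ¬sx (subst IsSignTriple tⱼ≡x (st j))))
                     (sym (count-absent t′ x (λ j t′ⱼ≡x → ¬sx (subst IsSignTriple t′ⱼ≡x (st′ j)))))
... | yes sx with parity-sign sx
...   | inj₁ even = trans (inv sx e₊-sign even) (trans same₊ (sym (inv′ sx e₊-sign even)))
...   | inj₂ odd  = trans (inv sx e₋-sign odd) (trans same₋ (sym (inv′ sx e₋-sign odd)))

scaleRows : ∀ {M N} → Vector ℤ M → Matrix M N → Matrix M N
scaleRows ρ H i j = ρ i ℤ.* H i j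

scaleRows-partialHadamard : ∀ {M N} {H : Matrix M N} (ρ : Vector ℤ M) →
  (∀ i → IsSign (ρ i)) → IsPartialHadamard H → IsPartialHadamard (scaleRows ρ H)
scaleRows-partialHadamard {H = H} ρ sρ (sH , orth) =
  (λ i j → sign-mul (sρ i) (sH i j)) , λ i k i≢k → begin
    dot (λ j → ρ i ℤ.* H i j) (λ j → ρ k ℤ.* H k j) ≡⟨ dot-scale (ρ i) (ρ k) (H i) (H k) ⟩
    ρ i ℤ.* ρ k ℤ.* dot (H i) (H k)                ≡⟨ cong (ρ i ℤ.* ρ k ℤ.*_) (orth i k i≢k) ⟩
    ρ i ℤ.* ρ k ℤ.* 0ℤ                             ≡⟨ ℤP.*-zeroʳ (ρ i ℤ.* ρ k) ⟩
    0ℤ                                             ∎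

rowSigns : ℤ → Vector ℤ 4
rowSigns s zero = 1ℤ
rowSigns s (suc zero) = s
rowSigns s (suc (suc _)) = 1ℤ

rowSigns-sign : ∀ {s} → IsSign s → ∀ i → IsSign (rowSigns s i)
rowSigns-sign ss zero = inj₁ refl
rowSigns-sign ss (suc zero) = ss
rowSigns-sign ss (suc (suc _)) = inj₁ refl

patternParitySum-rowSigns : ∀ {N} s (H : Matrix 4 N) →
  patternParitySum (scaleRows (rowSigns s) H) ≡ s ℤ.* patternParitySum H
patternParitySum-rowSigns s H =
  trans (ℤΣ.sum-cong-≗ (λ j → column s (H 0F j) (H 1F j) (H 2F j) (H 3F j)))
        (sym (ℤΣ.*-distribˡ-sum s (λ j → parity (patterns H j))))
  where
  column : ∀ s h₀ h₁ h₂ h₃ →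
    1ℤ ℤ.* h₀ ℤ.* (s ℤ.* h₁) ℤ.* (1ℤ ℤ.* h₀ ℤ.* (1ℤ ℤ.* h₂)) ℤ.* (1ℤ ℤ.* h₀ ℤ.* (1ℤ ℤ.* h₃))
      ≡ s ℤ.* (h₀ ℤ.* h₁ ℤ.* (h₀ ℤ.* h₂) ℤ.* (h₀ ℤ.* h₃))
  column = solve-∀

partialHadamard? : ∀ {M N} (H : Matrix M N) → Dec (IsPartialHadamard H)
partialHadamard? H =
  all? (λ i → all? λ j → sign? (H i j)) ×-dec
  all? (λ i → all? λ k → ¬? (i Fin.≟ k) →-dec (dot (H i) (H k) ℤ.≟ 0ℤ))

W₄-partialHadamard : IsPartialHadamard W₄
W₄-partialHadamard = toWitness {a? = partialHadamard? W₄} tt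

K₄-partialHadamard : IsPartialHadamard K₄
K₄-partialHadamard = toWitness {a? = partialHadamard? K₄} tt

concat⁺ : ∀ {A : Set} {P : A → Set} {m n} {xss : Vector (Vector A m) n} →
  (∀ k i → P (xss k i)) → ∀ i → P (concat xss i)
concat⁺ {m = m} {n} ps i = ps (proj₂ (Fin.quotRem {n} m i)) (proj₁ (Fin.quotRem {n} m i))

WK-sign : ∀ a b i j → IsSign (WK a b i j)
WK-sign a b i =
  ++⁺ IsSign (concat⁺ {P = IsSign} {xss = replicate a (W₄ i)} (λ _ → proj₁ W₄-partialHadamard i))
             (concat⁺ {P = IsSign} {xss = replicate b (K₄ i)} (λ _ → proj₁ K₄-partialHadamard i))

patterns-WK : ∀ a b →
  patterns (WK a b) ≗ concat (replicate a (patterns W₄)) ++ concat (replicate b (patterns K₄))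
patterns-WK a b j with splitAt (a * 4) j
... | inj₁ _ = refl
... | inj₂ _ = refl

count-patterns-WK : ∀ a b w →
  count (patterns (WK a b)) w ≡ a * count (patterns W₄) w + b * count (patterns K₄) w
count-patterns-WK a b w = begin
  count (patterns (WK a b)) w
    ≡⟨ count-cong (patterns-WK a b) w ⟩
  count (concat (replicate a (patterns W₄)) ++ concat (replicate b (patterns K₄))) w
    ≡⟨ count-++ (concat (replicate a (patterns W₄))) (concat (replicate b (patterns K₄))) w ⟩
  count (concat (replicate a (patterns W₄))) w + count (concat (replicate b (patterns K₄))) w
    ≡⟨ cong₂ _+_ (count-concat-replicate a (patterns W₄) w)
                 (count-concat-replicate b (patterns K₄) w) ⟩
  a * count (patterns W₄) w + b * count (patterns K₄) w ∎

WK-parityInvariant : ∀ a b → ParityInvariant (patterns (WK a b))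
WK-parityInvariant a b {v} {w} sv sw pv≡pw = begin
  count (patterns (WK a b)) v
    ≡⟨ count-patterns-WK a b v ⟩
  a * count (patterns W₄) v + b * count (patterns K₄) v
    ≡⟨ cong₂ (λ k l → a * k + b * l)
         (partialHadamard-parityInvariant W₄-partialHadamard sv sw pv≡pw)
         (partialHadamard-parityInvariant K₄-partialHadamard sv sw pv≡pw) ⟩
  a * count (patterns W₄) w + b * count (patterns K₄) w
    ≡⟨ count-patterns-WK a b w ⟨
  count (patterns (WK a b)) w ∎

-- W₄ has one column of pattern e₊ and none of pattern e₋; K₄ the reverse.
WK-count-even : ∀ a b → count (patterns (WK a b)) e₊ ≡ a
WK-count-even a b = trans (count-patterns-WK a b e₊)
  (trans (cong₂ _+_ (ℕP.*-identityʳ a) (ℕP.*-zeroʳ b)) (ℕP.+-identityʳ a))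

WK-count-odd : ∀ a b → count (patterns (WK a b)) e₋ ≡ b
WK-count-odd a b = trans (count-patterns-WK a b e₋)
  (cong₂ _+_ (ℕP.*-zeroʳ a) (ℕP.*-identityʳ b))

same-pattern-dephased : (u v : Fin 4 → ℤ) → IsSign (u 0F) → IsSign (v 0F) →
  patternOf u ≡ patternOf v → ∀ i → u 0F ℤ.* u i ≡ v 0F ℤ.* v i
same-pattern-dephased u v su sv same 0F = trans (sign-square su) (sym (sign-square sv))
same-pattern-dephased u v su sv same 1F = cong proj₁ same
same-pattern-dephased u v su sv same 2F = cong (proj₁ ∘ proj₂) same
same-pattern-dephased u v su sv same 3F = cong (proj₂ ∘ proj₂) same

same-pattern-proportional : (u v : Fin 4 → ℤ) → IsSign (u 0F) → IsSign (v 0F) →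
  patternOf u ≡ patternOf v → ∀ i → v i ≡ v 0F ℤ.* u 0F ℤ.* u i
same-pattern-proportional u v su sv same i = sign-solve sv (same-pattern-dephased u v su sv same i)

equivalent-by-patterns : ∀ {N N′} (ρ : Vector ℤ 4) {H : Matrix 4 N} {G : Matrix 4 N′} →
  (∀ i → IsSign (ρ i)) → (∀ i j → IsSign (H i j)) → (∀ i j → IsSign (G i j)) →
  (τ : Permutation N′ N) → (∀ j → patterns (scaleRows ρ H) (τ ⟨$⟩ʳ j) ≡ patterns G j) →
  Equivalent H G
equivalent-by-patterns {N′ = N′} ρ {H} {G} sρ sH sG τ match =
  id , τ , ρ , c , sρ , c-sign , entry
  where
  u : Fin N′ → Fin 4 → ℤ
  u j i = ρ i ℤ.* H i (τ ⟨$⟩ʳ j)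
  u₀-sign : ∀ j → IsSign (u j 0F)
  u₀-sign j = sign-mul (sρ 0F) (sH 0F _)
  c : Vector ℤ N′
  c j = G 0F j ℤ.* u j 0F
  c-sign : ∀ j → IsSign (c j)
  c-sign j = sign-mul (sG 0F j) (u₀-sign j)
  regroup : ∀ c r h → c ℤ.* (r ℤ.* h) ≡ r ℤ.* c ℤ.* h
  regroup = solve-∀
  entry : ∀ i j → G i j ≡ ρ i ℤ.* c j ℤ.* H (id ⟨$⟩ʳ i) (τ ⟨$⟩ʳ j)
  entry i j = trans (same-pattern-proportional (u j) (λ i → G i j) (u₀-sign j) (sG 0F j) (match j) i)
                    (regroup (c j) (ρ i) (H i (τ ⟨$⟩ʳ j)))

evenColumns oddColumns : ∀ {N} → ℤ → Matrix 4 N → ℕ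
evenColumns s H = count (patterns (scaleRows (rowSigns s) H)) e₊
oddColumns s H = count (patterns (scaleRows (rowSigns s) H)) e₋

rowSigns-count-formula : ∀ {N s} {H : Matrix 4 N} → IsSign s → IsPartialHadamard H →
  ∀ {w} → IsSignTriple w →
  + (8 * count (patterns (scaleRows (rowSigns s) H)) w)
    ≡ + N ℤ.+ parity w ℤ.* (s ℤ.* patternParitySum H)
rowSigns-count-formula {N} {s} {H} ss ph {w} sw =
  trans (pattern-count-formula (scaleRows-partialHadamard (rowSigns s) (rowSigns-sign ss) ph) sw)
        (cong (λ q → + N ℤ.+ parity w ℤ.* q) (patternParitySum-rowSigns s H))

balance : ∀ a b {N} q → + (8 * a) ≡ + N ℤ.+ parity e₊ ℤ.* q → + (8 * b) ≡ + N ℤ.+ parity e₋ ℤ.* q →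
  4 * (a + b) ≡ N
balance a b {N} q 8a≡ 8b≡ = ℕP.*-cancelˡ-≡ _ _ 2 (ℤP.+-injective (begin
  + (2 * (4 * (a + b)))                    ≡⟨ cong +_ (spread a b) ⟩
  + (8 * a) ℤ.+ + (8 * b)                  ≡⟨ cong₂ ℤ._+_ 8a≡ 8b≡ ⟩
  + N ℤ.+ parity e₊ ℤ.* q ℤ.+ (+ N ℤ.+ parity e₋ ℤ.* q) ≡⟨ cancel (+ N) q ⟩
  + 2 ℤ.* + N                              ≡⟨ ℤP.pos-* 2 N ⟨
  + (2 * N)                                ∎))
  where
  spread : ∀ a b → 2 * (4 * (a + b)) ≡ 8 * a + 8 * b
  spread = ℕSolver.solve-∀
  cancel : ∀ n q → n ℤ.+ 1ℤ ℤ.* 1ℤ ℤ.* 1ℤ ℤ.* q ℤ.+ (n ℤ.+ -1ℤ ℤ.* -1ℤ ℤ.* -1ℤ ℤ.* q) ≡ + 2 ℤ.* n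
  cancel = solve-∀

normal-form : ∀ {N} {H : Matrix 4 N} s → IsSign s → IsPartialHadamard H →
  (4 * (evenColumns s H + oddColumns s H) ≡ N) ×
  Equivalent H (WK (evenColumns s H) (oddColumns s H))
normal-form {N} {H} s ss ph =
  balance a b (s ℤ.* patternParitySum H) (rowSigns-count-formula ss ph e₊-sign)
                                     (rowSigns-count-formula ss ph e₋-sign) ,
  equivalent-by-patterns (rowSigns s) (rowSigns-sign ss) (proj₁ ph) (WK-sign a b)
                         (proj₁ matching) (proj₂ matching)
  where
  a b : ℕ
  a = evenColumns s H
  b = oddColumns s H
  ph′ : IsPartialHadamard (scaleRows (rowSigns s) H)
  ph′ = scaleRows-partialHadamard (rowSigns s) (rowSigns-sign ss) ph
  same-counts : ∀ x → count (patterns (scaleRows (rowSigns s) H)) x ≡ count (patterns (WK a b)) x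
  same-counts = parityInvariant-agree (patterns (scaleRows (rowSigns s) H)) (patterns (WK a b))
    (pattern-sign (proj₁ ph′)) (pattern-sign (WK-sign a b))
    (partialHadamard-parityInvariant ph′) (WK-parityInvariant a b)
    (sym (WK-count-even a b)) (sym (WK-count-odd a b))
  matching : Σ (Permutation (a * 4 + b * 4) N) λ τ →
    ∀ j → patterns (scaleRows (rowSigns s) H) (τ ⟨$⟩ʳ j) ≡ patterns (WK a b) j
  matching = matching-permutation (patterns (scaleRows (rowSigns s) H)) (patterns (WK a b)) same-counts

negate-row1-even : ∀ {N} {H : Matrix 4 N} → IsPartialHadamard H → evenColumns -1ℤ H ≡ oddColumns 1ℤ H
negate-row1-even {N} {H} ph = cancel-8 (begin
  + (8 * evenColumns -1ℤ H)             ≡⟨ rowSigns-count-formula (inj₂ refl) ph e₊-sign ⟩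
  + N ℤ.+ parity e₊ ℤ.* (-1ℤ ℤ.* Q)      ≡⟨ cong (ℤ._+_ (+ N)) (swap Q) ⟩
  + N ℤ.+ parity e₋ ℤ.* (1ℤ ℤ.* Q)       ≡⟨ rowSigns-count-formula (inj₁ refl) ph e₋-sign ⟨
  + (8 * oddColumns 1ℤ H)               ∎)
  where
  Q : ℤ
  Q = patternParitySum H
  swap : ∀ q → 1ℤ ℤ.* 1ℤ ℤ.* 1ℤ ℤ.* (-1ℤ ℤ.* q) ≡ -1ℤ ℤ.* -1ℤ ℤ.* -1ℤ ℤ.* (1ℤ ℤ.* q)
  swap = solve-∀

negate-row1-odd : ∀ {N} {H : Matrix 4 N} → IsPartialHadamard H → oddColumns -1ℤ H ≡ evenColumns 1ℤ H
negate-row1-odd {N} {H} ph = cancel-8 (begin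
  + (8 * oddColumns -1ℤ H)                 ≡⟨ rowSigns-count-formula (inj₂ refl) ph e₋-sign ⟩
  + N ℤ.+ parity e₋ ℤ.* (-1ℤ ℤ.* Q)         ≡⟨ cong (ℤ._+_ (+ N)) (swap Q) ⟩
  + N ℤ.+ parity e₊ ℤ.* (1ℤ ℤ.* Q)          ≡⟨ rowSigns-count-formula (inj₁ refl) ph e₊-sign ⟨
  + (8 * evenColumns 1ℤ H)                 ∎)
  where
  Q : ℤ
  Q = patternParitySum H
  swap : ∀ q → -1ℤ ℤ.* -1ℤ ℤ.* -1ℤ ℤ.* (-1ℤ ℤ.* q) ≡ 1ℤ ℤ.* 1ℤ ℤ.* 1ℤ ℤ.* (1ℤ ℤ.* q)
  swap = solve-∀

theorem4p7 : (N : ℕ) (H : Matrix 4 N) → IsPartialHadamard H →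
    Σ ℕ λ a → Σ ℕ λ b → (4 * (a + b) ≡ N) × (b ≤ a) × Equivalent H (WK a b)
theorem4p7 N H ph with oddColumns 1ℤ H ≤? evenColumns 1ℤ H
... | yes odd≤even =
  let (size , equivalent) = normal-form 1ℤ (inj₁ refl) ph
  in  _ , _ , size , odd≤even , equivalent
... | no odd≰even =
  let (size , equivalent) = normal-form -1ℤ (inj₂ refl) ph
  in  _ , _ , size , swapped , equivalent
  where
  swapped : oddColumns -1ℤ H ≤ evenColumns -1ℤ H
  swapped = subst₂ _≤_ (sym (negate-row1-odd ph)) (sym (negate-row1-even ph)) (ℕP.≰⇒≥ odd≰even)
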